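{- A graph $G$ with at least two vertices satisfies $\kappa(G)=2$ if and only if $G$ has a pair of true twins.
   Context: All graphs are finite, simple and connected; $d(u,v)$ is the distance. For vertices $x,y,s$ put $\Delta_s(x,y)=|d(x,s)-d(y,s)|$, $\Delta_S(x,y)=\sum_{s\in S}\Delta_s(x,y)$. For $k\ge1$, $S\subseteq V(G)$ is a weak $k$-resolving set if $\Delta_S(x,y)\ge k$ for all distinct $x,y\in V(G)$. $\kappa(G)$ is the largest $k$ such that $G$ has a weak $k$-resolving set (one says $G$ is weak $\kappa(G)$-metric dimensional). Distinct vertices $x,y$ are true twins if $N[x]=N[y]$ (closed neighborhoods). -}

module Defs where

open import Data.Nat using (ℕ; zero; suc; _+_; _≤_; ∣_-_∣)
open import Data.Fin using (Fin)
open import Data.Fin.Subset using (Subset)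
open import Data.Vec using (lookup)
open import Data.List using (map; allFin)
open import Data.Nat.ListAction using (sum)
open import Data.Bool using (Bool; true; false; if_then_else_)
open import Data.Product using (Σ; ∃; _×_)
open import Data.Sum using (_⊎_)
open import Relation.Binary.PropositionalEquality using (_≡_; _≢_)

record Graph : Set where
  field
    n      : ℕ
    E      : Fin n → Fin n → Bool
    E-sym  : ∀ x y → E x y ≡ E y x
    E-irr  : ∀ x → E x x ≡ false

open Graph public

Adj : (G : Graph) → Fin (n G) → Fin (n G) → Set
Adj G x y = E G x y ≡ true

data Walk (G : Graph) : Fin (n G) → Fin (n G) → ℕ → Set where
  nil  : ∀ {u} → Walk G u u zero
  cons : ∀ {u w v k} → Adj G u w → Walk G w v k → Walk G u v (suc k)

Connected : Graph → Set
Connected G = ∀ u v → ∃ λ k → Walk G u v k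

IsDistance : (G : Graph) → (Fin (n G) → Fin (n G) → ℕ) → Set
IsDistance G d = ∀ u v → Walk G u v (d u v) × (∀ k → Walk G u v k → d u v ≤ k)

ΔS : (G : Graph) → (Fin (n G) → Fin (n G) → ℕ) → Subset (n G) →
     Fin (n G) → Fin (n G) → ℕ
ΔS G d S x y =
  sum (map (λ s → if lookup S s then ∣ d x s - d y s ∣ else 0) (allFin (n G)))

WeakResolving : (G : Graph) → (Fin (n G) → Fin (n G) → ℕ) → ℕ → Subset (n G) → Set
WeakResolving G d k S = 1 ≤ k × (∀ x y → x ≢ y → k ≤ ΔS G d S x y)

KappaIs : (G : Graph) → (Fin (n G) → Fin (n G) → ℕ) → ℕ → Set
KappaIs G d k =
  (∃ λ S → WeakResolving G d k S) ×
  (∀ m S → WeakResolving G d m S → m ≤ k)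

InClosedNbhd : (G : Graph) → Fin (n G) → Fin (n G) → Set
InClosedNbhd G x z = z ≡ x ⊎ Adj G x z

TrueTwins : (G : Graph) → Fin (n G) → Fin (n G) → Set
TrueTwins G x y =
  x ≢ y ×
  (∀ z → (InClosedNbhd G x z → InClosedNbhd G y z) ×
         (InClosedNbhd G y z → InClosedNbhd G x z))

{-# OPTIONS --safe #-}
-- With S = V every pair x ≠ y is separated by at least 2, namely by the
-- terms s = x and s = y, which are d(y,x) and d(x,y). If x, y are true twins,
-- then d(x,s) = d(y,s) for every other s (a shortest walk from one twin
-- leaves through a common neighbour), and d(x,y) = 1, so Δ_S(x,y) ≤ 2 for
-- every S. If there are no true twins, some z lies in N[x] but not in N[y]
-- (or vice versa), and z separates x and y once more, so V is a weak
-- 3-resolving set.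
module Submission where

open import Defs
open import Data.Nat using (ℕ; zero; suc; _+_; _≤_; _<_; z≤n; s≤s; ∣_-_∣; _≤?_)
open import Data.Nat.Properties hiding (_≟_)
open import Data.Nat.ListAction using (sum)
open import Algebra.Properties.CommutativeSemigroup +-commutativeSemigroup using (x∙yz≈y∙xz)
open import Data.Fin using (Fin; zero; suc; _≟_)
open import Data.Fin.Properties using (any?)
open import Data.Fin.Subset using (Subset; ⊤)
open import Data.Vec using (lookup)
open import Data.Vec.Properties using (lookup-replicate)
open import Data.Vec.Functional using (updateAt)
open import Data.Vec.Functional.Properties using (updateAt-updates; updateAt-minimal)
open import Data.List using ([]; _∷_; map; tabulate; allFin)
open import Data.List.Properties using (map-tabulate; map-cong; map-cong-local)
open import Data.List.Relation.Unary.All as All using (All; []; _∷_)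
open import Data.List.Relation.Unary.Any using (here; there)
open import Data.List.Relation.Unary.Unique.Propositional using (Unique; []; _∷_)
open import Data.List.Membership.Propositional using (_∉_)
open import Data.Bool using (true; false; if_then_else_)
import Data.Bool.Properties as Bool
open import Data.Product using (∃₂; _,_; proj₁; proj₂)
open import Data.Sum using (_⊎_; inj₁; inj₂; [_,_]′)
open import Relation.Nullary using (¬_; Dec; yes; no; contradiction)
open import Relation.Nullary.Decidable using (¬?; _×-dec_; _⊎-dec_; decidable-stable)
open import Relation.Binary.PropositionalEquality
open import Function using (_∘_; id; const; mk⇔)
open import Function.Bundles using (_⇔_)

∑ : ∀ {m} → (Fin m → ℕ) → ℕ
∑ f = sum (tabulate f)

∑-zero : ∀ {m} (f : Fin m → ℕ) → (∀ s → f s ≡ 0) → ∑ f ≡ 0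
∑-zero {zero}  f f≡0 = refl
∑-zero {suc m} f f≡0 = cong₂ _+_ (f≡0 zero) (∑-zero (λ s → f (suc s)) (λ s → f≡0 (suc s)))

∑-remove : ∀ {m} (f : Fin m → ℕ) i → ∑ f ≡ f i + ∑ (updateAt f i (const 0))
∑-remove f zero    = refl
∑-remove f (suc i) = begin
  f zero + ∑ (λ s → f (suc s))
    ≡⟨ cong (f zero +_) (∑-remove (λ s → f (suc s)) i) ⟩
  f zero + (f (suc i) + ∑ (updateAt (λ s → f (suc s)) i (const 0)))
    ≡⟨ x∙yz≈y∙xz (f zero) (f (suc i)) _ ⟩
  f (suc i) + ∑ (updateAt f (suc i) (const 0))
    ∎
  where open ≡-Reasoning

sum-map-updateAt : ∀ {m} (f : Fin m → ℕ) i {is} → All (i ≢_) is →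
                   sum (map (updateAt f i (const 0)) is) ≡ sum (map f is)
sum-map-updateAt f i i∉is =
  cong sum (map-cong-local (All.map (λ i≢s → updateAt-minimal _ i f (≢-sym i≢s)) i∉is))

sum-distinct-≤-∑ : ∀ {m} (f : Fin m → ℕ) {is} → Unique is → sum (map f is) ≤ ∑ f
sum-distinct-≤-∑ f []                  = z≤n
sum-distinct-≤-∑ f {i ∷ is} (i∉is ∷ u) = begin
  f i + sum (map f is)  ≡⟨ cong (f i +_) (sum-map-updateAt f i i∉is) ⟨
  f i + sum (map g is)  ≤⟨ +-monoʳ-≤ (f i) (sum-distinct-≤-∑ g u) ⟩
  f i + ∑ g             ≡⟨ ∑-remove f i ⟨
  ∑ f                   ∎
  where
  open ≤-Reasoning
  g = updateAt f i (const 0)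

∑-supported : ∀ {m} (f : Fin m → ℕ) {is} → Unique is → (∀ s → s ∉ is → f s ≡ 0) →
              ∑ f ≡ sum (map f is)
∑-supported f []                  f≡0 = ∑-zero f (λ s → f≡0 s λ ())
∑-supported f {i ∷ is} (i∉is ∷ u) f≡0 = begin
  ∑ f                   ≡⟨ ∑-remove f i ⟩
  f i + ∑ g             ≡⟨ cong (f i +_) (∑-supported g u g≡0) ⟩
  f i + sum (map g is)  ≡⟨ cong (f i +_) (sum-map-updateAt f i i∉is) ⟩
  f i + sum (map f is)  ∎
  where
  open ≡-Reasoning
  g = updateAt f i (const 0)
  g≡0 : ∀ s → s ∉ is → g s ≡ 0
  g≡0 s s∉is with s ≟ i
  ... | yes refl = updateAt-updates i f
  ... | no  s≢i  = trans (updateAt-minimal s i f s≢i)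
                         (f≡0 s λ { (here s≡i) → s≢i s≡i ; (there s∈is) → s∉is s∈is })

1≤∣m-n∣ : ∀ {m n} → m < n → 1 ≤ ∣ m - n ∣
1≤∣m-n∣ m<n = n≢0⇒n>0 (λ ∣m-n∣≡0 → <⇒≢ m<n (∣m-n∣≡0⇒m≡n ∣m-n∣≡0))

module Distance (G : Graph) (d : Fin (n G) → Fin (n G) → ℕ) (isD : IsDistance G d) where

  private
    V = Fin (n G)
    variable
      u v x y z s : V

  walk-0 : Walk G u v 0 → u ≡ v
  walk-0 nil = refl

  walk-1 : Walk G u v 1 → Adj G u v
  walk-1 (cons uv nil) = uv

  d-refl : ∀ u → d u u ≡ 0
  d-refl u = n≤0⇒n≡0 (proj₂ (isD u u) 0 nil)

  d-adj : Adj G u v → d u v ≤ 1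
  d-adj uv = proj₂ (isD _ _) 1 (cons uv nil)

  d-pos : u ≢ v → 1 ≤ d u v
  d-pos {u} {v} u≢v with d u v | proj₁ (isD u v)
  ... | zero  | w = contradiction (walk-0 w) u≢v
  ... | suc _ | _ = s≤s z≤n

  d-nonadj : u ≢ v → ¬ Adj G u v → 2 ≤ d u v
  d-nonadj {u} {v} u≢v ¬uv with d u v | proj₁ (isD u v)
  ... | zero        | w = contradiction (walk-0 w) u≢v
  ... | suc zero    | w = contradiction (walk-1 w) ¬uv
  ... | suc (suc _) | _ = s≤s (s≤s z≤n)

  -- A shortest walk from y to s ≠ y starts with an edge into N[y] ⊆ N[x].
  d-antimono-N : (∀ z → InClosedNbhd G y z → InClosedNbhd G x z) → s ≢ y → d x s ≤ d y s
  d-antimono-N {y} {x} {s} N[y]⊆N[x] s≢y with d y s | proj₁ (isD y s)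
  ... | zero  | w = contradiction (sym (walk-0 w)) s≢y
  ... | suc k | cons {w = w} yw walk with N[y]⊆N[x] w (inj₂ yw)
  ...   | inj₁ refl = ≤-trans (proj₂ (isD x s) k walk) (n≤1+n k)
  ...   | inj₂ xw   = proj₂ (isD x s) (suc k) (cons xw walk)

  InClosedNbhd? : ∀ x z → Dec (InClosedNbhd G x z)
  InClosedNbhd? x z = (z ≟ x) ⊎-dec (E G x z Bool.≟ true)

  Δ-term : Subset (n G) → V → V → V → ℕ
  Δ-term S x y s = if lookup S s then ∣ d x s - d y s ∣ else 0

  ΔS≡∑ : ∀ S x y → ΔS G d S x y ≡ ∑ (Δ-term S x y)
  ΔS≡∑ S x y = cong sum (map-tabulate id (Δ-term S x y))

  Δ-term-≤ : ∀ S x y s → Δ-term S x y s ≤ ∣ d x s - d y s ∣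
  Δ-term-≤ S x y s with lookup S s
  ... | true  = ≤-refl
  ... | false = z≤n

  Δ-term-⊤ : ∀ x y s → Δ-term ⊤ x y s ≡ ∣ d x s - d y s ∣
  Δ-term-⊤ x y s rewrite lookup-replicate s true = refl

  ΔS-sym : ∀ S x y → ΔS G d S x y ≡ ΔS G d S y x
  ΔS-sym S x y = cong sum (map-cong term-sym (allFin (n G)))
    where
    term-sym : ∀ s → Δ-term S x y s ≡ Δ-term S y x s
    term-sym s = cong (λ t → if lookup S s then t else 0) (∣-∣-comm (d x s) (d y s))

  ∣d-d∣-left : ∀ x y → ∣ d x x - d y x ∣ ≡ d y x
  ∣d-d∣-left x y = cong (λ t → ∣ t - d y x ∣) (d-refl x)

  ∣d-d∣-right : ∀ x y → ∣ d x y - d y y ∣ ≡ d x y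
  ∣d-d∣-right x y = trans (cong (λ t → ∣ d x y - t ∣) (d-refl y)) (∣-∣-identityʳ (d x y))

  sum-distinct-≤-ΔS⊤ : ∀ {is} → Unique is → sum (map (λ s → ∣ d x s - d y s ∣) is) ≤ ΔS G d ⊤ x y
  sum-distinct-≤-ΔS⊤ {x} {y} {is} u = begin
    sum (map (λ s → ∣ d x s - d y s ∣) is) ≡⟨ cong sum (map-cong (Δ-term-⊤ x y) is) ⟨
    sum (map (Δ-term ⊤ x y) is)           ≤⟨ sum-distinct-≤-∑ (Δ-term ⊤ x y) u ⟩
    ∑ (Δ-term ⊤ x y)                      ≡⟨ ΔS≡∑ ⊤ x y ⟨
    ΔS G d ⊤ x y                          ∎
    where open ≤-Reasoning

  d+d-≤-ΔS⊤ : x ≢ y → d y x + d x y ≤ ΔS G d ⊤ x y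
  d+d-≤-ΔS⊤ {x} {y} x≢y = begin
    d y x + d x y                                   ≡⟨ cong₂ _+_ (∣d-d∣-left x y) (∣d-d∣-right x y) ⟨
    ∣ d x x - d y x ∣ + ∣ d x y - d y y ∣           ≡⟨ cong (∣ d x x - d y x ∣ +_) (+-identityʳ ∣ d x y - d y y ∣) ⟨
    sum (map (λ s → ∣ d x s - d y s ∣) (x ∷ y ∷ [])) ≤⟨ sum-distinct-≤-ΔS⊤ ((x≢y ∷ []) ∷ [] ∷ []) ⟩
    ΔS G d ⊤ x y                                    ∎
    where open ≤-Reasoning

  d+d+∣d-d∣-≤-ΔS⊤ : x ≢ y → x ≢ z → y ≢ z → d y x + d x y + ∣ d x z - d y z ∣ ≤ ΔS G d ⊤ x y
  d+d+∣d-d∣-≤-ΔS⊤ {x} {y} {z} x≢y x≢z y≢z = begin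
    d y x + d x y + ∣ d x z - d y z ∣
      ≡⟨ cong₂ (λ a b → a + b + ∣ d x z - d y z ∣) (∣d-d∣-left x y) (∣d-d∣-right x y) ⟨
    ∣ d x x - d y x ∣ + ∣ d x y - d y y ∣ + ∣ d x z - d y z ∣
      ≡⟨ +-assoc ∣ d x x - d y x ∣ ∣ d x y - d y y ∣ ∣ d x z - d y z ∣ ⟩
    ∣ d x x - d y x ∣ + (∣ d x y - d y y ∣ + ∣ d x z - d y z ∣)
      ≡⟨ cong (λ t → ∣ d x x - d y x ∣ + (∣ d x y - d y y ∣ + t)) (+-identityʳ ∣ d x z - d y z ∣) ⟨
    sum (map (λ s → ∣ d x s - d y s ∣) (x ∷ y ∷ z ∷ []))
      ≤⟨ sum-distinct-≤-ΔS⊤ ((x≢y ∷ x≢z ∷ []) ∷ (y≢z ∷ []) ∷ [] ∷ []) ⟩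
    ΔS G d ⊤ x y
      ∎
    where open ≤-Reasoning

  ⊤-weak-2-resolving : WeakResolving G d 2 ⊤
  ⊤-weak-2-resolving = s≤s z≤n , λ x y x≢y →
    ≤-trans (+-mono-≤ (d-pos (≢-sym x≢y)) (d-pos x≢y)) (d+d-≤-ΔS⊤ x≢y)

  ΔS-≤-2-at-twins : TrueTwins G x y → ∀ S → ΔS G d S x y ≤ 2
  ΔS-≤-2-at-twins {x} {y} (x≢y , N[x]≡N[y]) S = begin
    ΔS G d S x y                          ≡⟨ ΔS≡∑ S x y ⟩
    ∑ (Δ-term S x y)                      ≡⟨ ∑-supported (Δ-term S x y) ((x≢y ∷ []) ∷ [] ∷ []) vanishes ⟩
    Δ-term S x y x + (Δ-term S x y y + 0) ≤⟨ +-mono-≤ at-x (+-monoˡ-≤ 0 at-y) ⟩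
    2                                     ∎
    where
    open ≤-Reasoning
    y∼x : Adj G y x
    y∼x with proj₁ (N[x]≡N[y] x) (inj₁ refl)
    ... | inj₁ x≡y = contradiction x≡y x≢y
    ... | inj₂ yx  = yx
    x∼y : Adj G x y
    x∼y = trans (E-sym G x y) y∼x
    at-x : Δ-term S x y x ≤ 1
    at-x = ≤-trans (Δ-term-≤ S x y x) (≤-trans (≤-reflexive (∣d-d∣-left x y)) (d-adj y∼x))
    at-y : Δ-term S x y y ≤ 1
    at-y = ≤-trans (Δ-term-≤ S x y y) (≤-trans (≤-reflexive (∣d-d∣-right x y)) (d-adj x∼y))
    vanishes : ∀ s → s ∉ x ∷ y ∷ [] → Δ-term S x y s ≡ 0
    vanishes s s∉xy = n≤0⇒n≡0 (≤-trans (Δ-term-≤ S x y s) (≤-reflexive (m≡n⇒∣m-n∣≡0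
      (≤-antisym (d-antimono-N (λ z → proj₂ (N[x]≡N[y] z)) (λ s≡y → s∉xy (there (here s≡y))))
                 (d-antimono-N (λ z → proj₁ (N[x]≡N[y] z)) (λ s≡x → s∉xy (here s≡x)))))))

  3-≤-ΔS⊤-if-separated : x ≢ y → InClosedNbhd G x z → ¬ InClosedNbhd G y z → 3 ≤ ΔS G d ⊤ x y
  3-≤-ΔS⊤-if-separated {x} {y} x≢y (inj₁ refl) x∉N[y] = ≤-trans
    (+-mono-≤ (d-nonadj (≢-sym x≢y) (x∉N[y] ∘ inj₂)) (d-pos x≢y))
    (d+d-≤-ΔS⊤ x≢y)
  3-≤-ΔS⊤-if-separated {x} {y} {z} x≢y (inj₂ x∼z) z∉N[y] = ≤-trans
    (+-mono-≤ (+-mono-≤ (d-pos (≢-sym x≢y)) (d-pos x≢y)) (1≤∣m-n∣ d[x,z]<d[y,z]))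
    (d+d+∣d-d∣-≤-ΔS⊤ x≢y x≢z y≢z)
    where
    x≢z : x ≢ z
    x≢z refl = contradiction (trans (sym x∼z) (E-irr G x)) λ ()
    y≢z : y ≢ z
    y≢z y≡z = z∉N[y] (inj₁ (sym y≡z))
    d[x,z]<d[y,z] : d x z < d y z
    d[x,z]<d[y,z] = ≤-trans (s≤s (d-adj x∼z)) (d-nonadj y≢z (z∉N[y] ∘ inj₂))

  twins-if-unseparated : x ≢ y → ¬ 3 ≤ ΔS G d ⊤ x y → TrueTwins G x y
  twins-if-unseparated {x} {y} x≢y ¬3≤Δ =
    x≢y , λ z → N-⊆ x≢y ¬3≤Δ , N-⊆ (≢-sym x≢y) (¬3≤Δ ∘ subst (3 ≤_) (ΔS-sym ⊤ y x))
    where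
    N-⊆ : ∀ {x y z} → x ≢ y → ¬ 3 ≤ ΔS G d ⊤ x y → InClosedNbhd G x z → InClosedNbhd G y z
    N-⊆ {y = y} {z} x≢y ¬3≤Δ z∈N[x] = decidable-stable (InClosedNbhd? y z)
      λ z∉N[y] → ¬3≤Δ (3-≤-ΔS⊤-if-separated x≢y z∈N[x] z∉N[y])

  twins-or-⊤-weak-3-resolving : (∃₂ λ x y → TrueTwins G x y) ⊎ WeakResolving G d 3 ⊤
  twins-or-⊤-weak-3-resolving
    with any? (λ x → any? (λ y → ¬? (x ≟ y) ×-dec ¬? (3 ≤? ΔS G d ⊤ x y)))
  ... | yes (x , y , x≢y , ¬3≤Δ) = inj₁ (x , y , twins-if-unseparated x≢y ¬3≤Δ)
  ... | no  ¬unseparated         = inj₂ (s≤s z≤n , λ x y x≢y →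
          decidable-stable (3 ≤? ΔS G d ⊤ x y) λ ¬3≤Δ → ¬unseparated (x , y , x≢y , ¬3≤Δ))

proposition3p1 : (G : Graph) → Connected G → 2 ≤ n G →
    (d : Fin (n G) → Fin (n G) → ℕ) → IsDistance G d →
    KappaIs G d 2 ⇔ (∃₂ λ x y → TrueTwins G x y)
proposition3p1 G _ _ d isD = mk⇔ twins-if-κ≡2 κ≡2-if-twins
  where
  open Distance G d isD

  twins-if-κ≡2 : KappaIs G d 2 → ∃₂ λ x y → TrueTwins G x y
  twins-if-κ≡2 (_ , maximal) =
    [ id , (λ ⊤-3-resolving → contradiction (maximal 3 ⊤ ⊤-3-resolving) (<-irrefl refl)) ]′
    twins-or-⊤-weak-3-resolving

  κ≡2-if-twins : (∃₂ λ x y → TrueTwins G x y) → KappaIs G d 2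
  κ≡2-if-twins (x , y , twins) =
    (⊤ , ⊤-weak-2-resolving) ,
    λ m S (_ , resolving) → ≤-trans (resolving x y (proj₁ twins)) (ΔS-≤-2-at-twins twins S)
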